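{- Let $n\ge2$ be square-free with exactly $k$ distinct prime factors. Then $\Gamma(\mathbb{Z}_n)$ is $k$-partite, i.e. its vertex set can be partitioned into $k$ sets none of which contains two adjacent vertices.
   Context: For a commutative ring $R$ with identity, the zero-divisor graph $\Gamma(R)$ is the simple undirected graph whose vertices are the nonzero zero-divisors of $R$, two distinct vertices $u,v$ being adjacent iff $uv=0$. -}

module Defs where

open import Data.Nat using (ℕ; zero; suc; _*_; _%_; NonZero; _≥_)
open import Data.Nat.Divisibility using (_∣_)
open import Data.Nat.Primality using (Prime)
open import Data.List using (List; length)
open import Data.List.Membership.Propositional using (_∈_)
open import Data.List.Relation.Unary.Unique.Propositional using (Unique)
open import Data.Fin using (Fin; toℕ)
open import Data.Product using (Σ; _×_; _,_; ∃)
open import Relation.Binary.PropositionalEquality using (_≡_)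
open import Relation.Nullary using (¬_)
open import Function.Bundles using (_⇔_)

SquareFree : ℕ → Set
SquareFree n = ∀ p → Prime p → ¬ (p * p ∣ n)

HasKDistinctPrimeFactors : ℕ → ℕ → Set
HasKDistinctPrimeFactors n k =
  Σ (List ℕ) λ ps → Unique ps × length ps ≡ k × (∀ p → (p ∈ ps) ⇔ (Prime p × p ∣ n))

module Zmod (n : ℕ) .{{_ : NonZero n}} where

  Zn : Set
  Zn = Fin n

  MulZero : Zn → Zn → Set
  MulZero x y = (toℕ x * toℕ y) % n ≡ 0

  NonZeroElt : Zn → Set
  NonZeroElt x = ¬ (toℕ x ≡ 0)

  IsZeroDivisor : Zn → Set
  IsZeroDivisor x = NonZeroElt x × ∃ λ y → NonZeroElt y × MulZero x y

  Vertex : Set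
  Vertex = Σ Zn IsZeroDivisor

  Adjacent : Vertex → Vertex → Set
  Adjacent (u , _) (v , _) = ¬ (u ≡ v) × MulZero u v

  KPartite : ℕ → Set
  KPartite k = Σ (Vertex → Fin k) λ part →
    ∀ u v → Adjacent u v → ¬ (part u ≡ part v)

-- Colour a vertex x of Γ(ℤₙ) by a prime factor p of n with p ∤ x; one exists
-- because n is square-free and n ∤ x.  If x and y get the same colour p, then
-- p ∤ xy by Euclid's lemma, whereas xy ≡ 0 (mod n) forces p ∣ xy.
module Submission where

open import Defs
open import Data.Nat using (ℕ; zero; suc; _*_; _≥_; NonZero; ≢-nonZero; ≢-nonZero⁻¹)
open import Data.Nat.Properties using (*-identityˡ)
open import Data.Nat.Divisibility
  using (_∣_; _∣?_; divides; ∣-trans; *-pres-∣; ∣m⇒∣m*n; m∣m*n; >⇒∤; m%n≡0⇒n∣m)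
open import Data.Nat.GCD using (gcd; gcd[m,n]∣m; gcd[m,n]∣n; gcd-greatest)
open import Data.Nat.Primality using (Prime; euclidsLemma)
open import Data.Nat.Primality.Factorisation using (factorise)
open import Data.List using (List; []; _∷_; length; lookup)
open import Data.Nat.ListAction using (product)
open import Data.List.Relation.Unary.All using (All; _∷_) renaming (lookup to All-lookup)
open import Data.List.Relation.Unary.All.Properties using (¬All⇒Any¬)
open import Data.List.Relation.Unary.Any using (Any; index)
open import Data.List.Relation.Unary.Any.Properties using (lookup-index)
open import Data.List.Membership.Propositional using (_∈_)
open import Data.List.Membership.Propositional.Properties using (∈-lookup)
open import Data.Fin using (Fin; toℕ)
open import Data.Fin.Properties using (toℕ<n)
open import Data.Product using (_×_; _,_; ∃; proj₁)
open import Data.Sum using ([_,_])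
open import Data.Empty using (⊥-elim)
open import Relation.Nullary using (¬_)
open import Relation.Binary.PropositionalEquality using (_≡_; refl; sym; trans; subst)
open import Function.Bundles using (_⇔_; Equivalence)

prime-divisor : ∀ m .{{_ : NonZero m}} → ¬ m ≡ 1 → ∃ λ q → Prime q × q ∣ m
prime-divisor m m≢1 with factorise m
... | record { factors = [] ; isFactorisation = m≡1 } = ⊥-elim (m≢1 m≡1)
... | record { factors = q ∷ qs ; isFactorisation = m≡q*qs ; factorsPrime = q-prime ∷ _ } =
  q , q-prime , subst (q ∣_) (sym m≡q*qs) (m∣m*n (product qs))

-- Write n = d · gcd(x, n); a prime factor of d cannot divide x, since it
-- would then divide gcd(x, n) as well and its square would divide n.
squareFree⇒prime∤ : ∀ {n x} .{{_ : NonZero n}} → SquareFree n → ¬ n ∣ x →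
  ∃ λ q → Prime q × q ∣ n × ¬ q ∣ x
squareFree⇒prime∤ {n} {x} squareFree n∤x with gcd[m,n]∣n x n
... | divides zero n≡0 = ⊥-elim (≢-nonZero⁻¹ n n≡0)
... | divides (suc zero) n≡1*g =
  ⊥-elim (n∤x (subst (_∣ x) (sym (trans n≡1*g (*-identityˡ _))) (gcd[m,n]∣m x n)))
... | divides d@(suc (suc _)) n≡d*g with prime-divisor d (λ ())
... | q , q-prime , q∣d = q , q-prime , q∣n , q∤x
  where
    q∣n : q ∣ n
    q∣n = subst (q ∣_) (sym n≡d*g) (∣m⇒∣m*n (gcd x n) q∣d)
    q∤x : ¬ q ∣ x
    q∤x q∣x = squareFree q q-prime
      (subst (q * q ∣_) (sym n≡d*g) (*-pres-∣ q∣d (gcd-greatest q∣x q∣n)))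

primeFactor∤ : ∀ {n x} .{{_ : NonZero n}} (ps : List ℕ) →
  (∀ p → (p ∈ ps) ⇔ (Prime p × p ∣ n)) → SquareFree n → ¬ n ∣ x →
  Any (λ p → ¬ p ∣ x) ps
primeFactor∤ {n} {x} ps ps≡primeFactors squareFree n∤x = ¬All⇒Any¬ (_∣? x) ps all∣x⇒⊥
  where
    all∣x⇒⊥ : ¬ All (_∣ x) ps
    all∣x⇒⊥ all∣x with squareFree⇒prime∤ squareFree n∤x
    ... | q , q-prime , q∣n , q∤x =
      q∤x (All-lookup all∣x (Equivalence.from (ps≡primeFactors q) (q-prime , q∣n)))

prime∤* : ∀ {p x y} → Prime p → ¬ p ∣ x → ¬ p ∣ y → ¬ p ∣ x * y
prime∤* {x = x} {y} p-prime p∤x p∤y p∣xy = [ p∤x , p∤y ] (euclidsLemma x y p-prime p∣xy)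

theorem2p6 : (n k : ℕ) .{{_ : NonZero n}} → n ≥ 2 → SquareFree n →
    HasKDistinctPrimeFactors n k → Zmod.KPartite n k
theorem2p6 n .(length ps) _ squareFree (ps , _ , refl , ps≡primeFactors) = colour , proper
  where
    open Zmod n

    nondivisor : (v : Vertex) → Any (λ p → ¬ p ∣ toℕ (proj₁ v)) ps
    nondivisor (x , x≢0 , _) =
      primeFactor∤ ps ps≡primeFactors squareFree (>⇒∤ {{≢-nonZero x≢0}} (toℕ<n x))

    colour : Vertex → Fin (length ps)
    colour v = index (nondivisor v)

    proper : ∀ u v → Adjacent u v → ¬ colour u ≡ colour v
    proper u v (_ , uv≡0) same-colour with Equivalence.to (ps≡primeFactors _) (∈-lookup (colour u))
    ... | p-prime , p∣n =
      prime∤* p-prime (lookup-index (nondivisor u))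
        (subst (λ i → ¬ lookup ps i ∣ toℕ (proj₁ v)) (sym same-colour) (lookup-index (nondivisor v)))
        (∣-trans p∣n (m%n≡0⇒n∣m _ n uv≡0))
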